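{- Let $P_1=\tfrac12$ and $P_{k+1}=\tfrac12+\tfrac12P_k^2$. Then $P_k\to1$ as $k\to\infty$. Equivalently, the probability that a uniformly random unicard initial state (on any $n\ge 2^k$ cards, with either random putback or WL-putback) gives a single-use game in which Alice loses within her first $k$ passthroughs tends to $1$ as $k\to\infty$.
   Context: War with $n$ cards labelled $1,\dots,n$; a unicard state is one where Alice holds exactly one card. In a round both reveal their top card and the owner of the higher card places both cards at the bottom of their hand (WL-putback: winning card first, losing card second; random putback: uniformly random order). A player with no cards loses. Single-use: Alice loses before Bob plays any card he won. Passthroughs of Alice's hand: the first passthrough is the first round; if Alice holds $m'$ cards at the end of a passthrough, the next passthrough consists of the next $m'$ rounds. The probability in question equals $P_k$ for every $n\ge 2^k$ and for both putback rules. -}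

module Defs where

open import Data.Nat using (ℕ; zero; suc)
open import Data.Rational using (ℚ; 0ℚ; ½; _+_; _*_)

-- P k is the paper's P_k for k ≥ 1 (P 0 = 0 is an auxiliary seed, so that
-- P 1 = ½ + ½ * 0 * 0 = ½ and P (k+1) = ½ + ½ * (P k)^2).
P : ℕ → ℚ
P zero = 0ℚ
P (suc k) = ½ + ½ * (P k * P k)

{-# OPTIONS --safe #-}
module Submission where

-- The gap g_k = 1 - P_k satisfies g_{k+1} = g_k - g_k²/2, so it is non-increasing in
-- [0,1] and, while g_k ≥ ε, it drops by at least ε²/2 per step; by the Archimedean
-- property it therefore falls below ε after finitely many steps, and stays there.

open import Defs
open import Data.Nat using (ℕ; _≤_)
open import Data.Product using (∃-syntax)
open import Data.Rational using (ℚ; 0ℚ; 1ℚ; _-_; ∣_∣; _<_)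

open import Data.Empty using (⊥-elim)
import Data.Integer as ℤ
import Data.Integer.Solver as ℤ-Solver
import Data.Nat as ℕ
import Data.Nat.Coprimality as Coprimality
import Data.Nat.Properties as ℕ
open import Data.Product using (_,_; _×_; proj₁; proj₂)
open import Data.Rational
  using (mkℚ; ½; _+_; _*_; -_; 1/_; Positive; positive; nonNegative; *≤*; *<*)
  renaming (_≤_ to _≤ℚ_)
open import Data.Rational.Properties
import Data.Rational.Solver as ℚ-Solver
import Data.Rational.Unnormalised as ℚᵘ
import Data.Rational.Unnormalised.Properties as ℚᵘ
open import Data.Sum using (_⊎_; inj₁; inj₂)
open import Function using (_∘_)
open import Relation.Binary.PropositionalEquality using (_≡_; refl; sym; trans; cong; subst)
open import Relation.Nullary using (yes; no)

fromℕ : ℕ → ℚ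
fromℕ k = mkℚ (ℤ.+ k) 0 (Coprimality.sym (Coprimality.1-coprimeTo k))

fromℕ-suc : ∀ k → fromℕ (ℕ.suc k) ≡ 1ℚ + fromℕ k
fromℕ-suc k = toℚᵘ-injective
  (ℚᵘ.≃-trans (ℚᵘ.*≡* (solve 1 (λ x → (con (ℤ.+ 1) :+ x) :* (con (ℤ.+ 1) :* con (ℤ.+ 1))
                                      := (con (ℤ.+ 1) :* con (ℤ.+ 1) :+ x :* con (ℤ.+ 1)) :* con (ℤ.+ 1))
                              refl (ℤ.+ k)))
              (ℚᵘ.≃-sym (toℚᵘ-homo-+ 1ℚ (fromℕ k))))
  where open ℤ-Solver.+-*-Solver

-- For c = (n+1)/(d+1) we have 1/c ≤ d+1 < d+2.
archimedean : ∀ c → .{{Positive c}} → ∃[ K ] 1ℚ < fromℕ K * c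
archimedean c@(mkℚ ℤ.+[1+ n ] d _) = K , subst (_< fromℕ K * c) (*-inverseˡ c) (*-monoˡ-<-pos c 1/c<K)
  where
    K : ℕ
    K = ℕ.suc (ℕ.suc d)
    1/c<K : 1/ c < fromℕ K
    1/c<K = *<* (ℤ.+<+ (ℕ.<-≤-trans (ℕ.≤-reflexive (cong ℕ.suc (ℕ.*-identityʳ (ℕ.suc d))))
                                    (ℕ.m≤m*n K (ℕ.suc n))))

p≤p+q : ∀ p {q} → 0ℚ ≤ℚ q → p ≤ℚ p + q
p≤p+q p {q} 0≤q = subst (_≤ℚ p + q) (+-identityʳ p) (+-monoʳ-≤ p 0≤q)

0≤p*q : ∀ {p q} → 0ℚ ≤ℚ p → 0ℚ ≤ℚ q → 0ℚ ≤ℚ p * q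
0≤p*q {p} {q} 0≤p 0≤q = nonNegative⁻¹ (p * q) {{nonNeg*nonNeg⇒nonNeg p {{nonNegative 0≤p}} q {{nonNegative 0≤q}}}}

*-self-mono-≤-nonNeg : ∀ {p q} → 0ℚ ≤ℚ p → p ≤ℚ q → p * p ≤ℚ q * q
*-self-mono-≤-nonNeg {p} {q} 0≤p p≤q =
  ≤-trans (*-monoˡ-≤-nonNeg p {{nonNegative 0≤p}} p≤q)
          (*-monoʳ-≤-nonNeg q {{nonNegative (≤-trans 0≤p p≤q)}} p≤q)

module _ (a : ℕ → ℚ) {ε c : ℚ}
         (antitone : ∀ k → a (ℕ.suc k) ≤ℚ a k)
         (decrease : ∀ k → ε ≤ℚ a k → a (ℕ.suc k) + c ≤ℚ a k) where

  antitone⇒≤ : ∀ {m n} → m ≤ n → a n ≤ℚ a m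
  antitone⇒≤ = go ∘ ℕ.≤⇒≤′
    where
      go : ∀ {m n} → m ℕ.≤′ n → a n ≤ℚ a m
      go ℕ.≤′-refl       = ≤-refl
      go (ℕ.≤′-step m≤n) = ≤-trans (antitone _) (go m≤n)

  below-or-descended : ∀ k → a k < ε ⊎ a k + fromℕ k * c ≤ℚ a 0
  below-or-descended ℕ.zero = inj₂ (≤-reflexive (trans (cong (a 0 +_) (*-zeroˡ c)) (+-identityʳ (a 0))))
  below-or-descended (ℕ.suc k) with below-or-descended k | a k <? ε
  ... | inj₁ ak<ε | _       = inj₁ (≤-<-trans (antitone k) ak<ε)
  ... | inj₂ _    | yes ak<ε = inj₁ (≤-<-trans (antitone k) ak<ε)
  ... | inj₂ desc | no ak≮ε = inj₂ (begin
      a (ℕ.suc k) + fromℕ (ℕ.suc k) * c  ≡⟨ regroup ⟩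
      (a (ℕ.suc k) + c) + fromℕ k * c    ≤⟨ +-monoˡ-≤ (fromℕ k * c) (decrease k (≮⇒≥ ak≮ε)) ⟩
      a k + fromℕ k * c                  ≤⟨ desc ⟩
      a 0                                ∎)
    where
      open ≤-Reasoning
      open ℚ-Solver.+-*-Solver
      regroup : a (ℕ.suc k) + fromℕ (ℕ.suc k) * c ≡ (a (ℕ.suc k) + c) + fromℕ k * c
      regroup rewrite fromℕ-suc k =
        solve 3 (λ x y z → x :+ (con 1ℚ :+ z) :* y := (x :+ y) :+ z :* y) refl (a (ℕ.suc k)) c (fromℕ k)

  eventually-below : .{{Positive c}} → (∀ k → 0ℚ ≤ℚ a k) → a 0 ≤ℚ 1ℚ →
                     ∃[ K ] ∀ k → K ≤ k → a k < ε
  eventually-below nonNeg a₀≤1 with archimedean c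
  ... | K , 1<Kc = K , λ k K≤k → ≤-<-trans (antitone⇒≤ K≤k) aK<ε
    where
      open ≤-Reasoning
      aK<ε : a K < ε
      aK<ε with below-or-descended K
      ... | inj₁ aK<ε = aK<ε
      ... | inj₂ desc = ⊥-elim (<-irrefl refl (begin-strict
        1ℚ                  <⟨ 1<Kc ⟩
        fromℕ K * c         ≤⟨ subst (fromℕ K * c ≤ℚ_) (+-comm (fromℕ K * c) (a K)) (p≤p+q _ (nonNeg K)) ⟩
        a K + fromℕ K * c   ≤⟨ desc ⟩
        a 0                 ≤⟨ a₀≤1 ⟩
        1ℚ                  ∎))

0≤½ : 0ℚ ≤ℚ ½
0≤½ = *≤* (ℤ.+≤+ ℕ.z≤n)

P-bounds : ∀ k → 0ℚ ≤ℚ P k × P k ≤ℚ 1ℚ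
P-bounds ℕ.zero    = ≤-refl , *≤* (ℤ.+≤+ ℕ.z≤n)
P-bounds (ℕ.suc k) with P-bounds k
... | 0≤p , p≤1 =
  ≤-trans 0≤½ (p≤p+q ½ (0≤p*q 0≤½ (0≤p*q 0≤p 0≤p))) ,
  +-monoʳ-≤ ½ (*-monoˡ-≤-nonNeg ½ (*-self-mono-≤-nonNeg 0≤p p≤1))

gap : ℕ → ℚ
gap k = 1ℚ - P k

gap-step : ∀ k → gap (ℕ.suc k) + ½ * (gap k * gap k) ≡ gap k
gap-step k = solve 1 (λ p → (con 1ℚ :- (con ½ :+ con ½ :* (p :* p))) :+ con ½ :* ((con 1ℚ :- p) :* (con 1ℚ :- p))
                           := con 1ℚ :- p) refl (P k)
  where open ℚ-Solver.+-*-Solver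

gap-nonNeg : ∀ k → 0ℚ ≤ℚ gap k
gap-nonNeg k = subst (_≤ℚ gap k) (+-inverseʳ (P k)) (+-monoˡ-≤ (- P k) (proj₂ (P-bounds k)))

gap-antitone : ∀ k → gap (ℕ.suc k) ≤ℚ gap k
gap-antitone k = subst (gap (ℕ.suc k) ≤ℚ_) (gap-step k)
  (p≤p+q _ (0≤p*q 0≤½ (0≤p*q (gap-nonNeg k) (gap-nonNeg k))))

gap-decrease : ∀ {ε} → 0ℚ ≤ℚ ε → ∀ k → ε ≤ℚ gap k → gap (ℕ.suc k) + ½ * (ε * ε) ≤ℚ gap k
gap-decrease {ε} 0≤ε k ε≤gap = subst (gap (ℕ.suc k) + ½ * (ε * ε) ≤ℚ_) (gap-step k)
  (+-monoʳ-≤ (gap (ℕ.suc k)) (*-monoˡ-≤-nonNeg ½ (*-self-mono-≤-nonNeg 0≤ε ε≤gap)))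

corollary5p7 : ∀ (ε : ℚ) → 0ℚ < ε →
    ∃[ K ] ∀ (k : ℕ) → K ≤ k → ∣ 1ℚ - P k ∣ < ε
corollary5p7 ε 0<ε = K , λ k K≤k → subst (_< ε) (sym (0≤p⇒∣p∣≡p (gap-nonNeg k))) (gap<ε k K≤k)
  where
    instance
      ε-pos : Positive ε
      ε-pos = positive 0<ε
      ½ε²-pos : Positive (½ * (ε * ε))
      ½ε²-pos = pos*pos⇒pos ½ (ε * ε) {{pos*pos⇒pos ε ε}}
    gap-eventually-below : ∃[ K ] ∀ k → K ≤ k → gap k < ε
    gap-eventually-below = eventually-below gap gap-antitone (gap-decrease (<⇒≤ 0<ε)) gap-nonNeg ≤-refl
    K : ℕ
    K = proj₁ gap-eventually-below
    gap<ε : ∀ k → K ≤ k → gap k < ε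
    gap<ε = proj₂ gap-eventually-below
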